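{- Let $b\ge1$ be an integer, let $\mathcal{K}$ be the $(b+2)$-core of a graph, and let $F$ be an induced subgraph of $\mathcal{K}$ with $\mathrm{exc}(F)\ge0$ and $|\partial F|\le b|V(F)|$. Let $C$ be the $2$-core of $F$ (which is nonempty). Then $\mathrm{exc}(C)\ge\mathrm{exc}(F)$ and $|\partial C|\le b|V(C)|$.
   Context: The $j$-core of a graph is its largest subgraph of minimum degree at least $j$. The excess of a graph $H$ is $\mathrm{exc}(H)=|E(H)|-|V(H)|$. For a subgraph $H\subseteq\mathcal{K}$, $\partial H$ is the set of edges of $\mathcal{K}$ with exactly one endpoint in $V(H)$. -}

module Defs where

open import Data.Nat using (ℕ; zero; suc; _+_; _≤_; _<ᵇ_)
open import Data.Integer using (ℤ; +_; _-_)
open import Data.Fin using (Fin; toℕ)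
import Data.Fin as Fin
open import Data.Bool using (Bool; true; false; if_then_else_; _∧_; _xor_)
open import Data.Product using (_×_)
open import Relation.Binary.PropositionalEquality using (_≡_)

record Graph : Set where
  field
    n      : ℕ
    adj    : Fin n → Fin n → Bool
    sym    : ∀ i j → adj i j ≡ adj j i
    irrefl : ∀ i → adj i i ≡ false
open Graph public

-- Vertex sets, given by characteristic functions.  A vertex set S of a graph G
-- stands for the induced subgraph G[S].
VSet : Graph → Set
VSet G = Fin (n G) → Bool

sumF : ∀ {m} → (Fin m → ℕ) → ℕ
sumF {zero}  f = 0
sumF {suc m} f = f Fin.zero + sumF (λ i → f (Fin.suc i))

countF : ∀ {m} → (Fin m → Bool) → ℕ
countF f = sumF (λ i → if f i then 1 else 0)

module _ (G : Graph) where

  _⊆V_ : VSet G → VSet G → Set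
  S ⊆V T = ∀ v → S v ≡ true → T v ≡ true

  size : VSet G → ℕ
  size S = countF S

  deg : VSet G → Fin (n G) → ℕ
  deg S v = countF (λ u → S u ∧ adj G v u)

  edges : VSet G → ℕ
  edges S = sumF (λ u → if S u
                then countF (λ v → S v ∧ adj G u v ∧ (toℕ u <ᵇ toℕ v))
                else 0)
  exc : VSet G → ℤ
  exc S = + edges S - + size S

  -- ∂_K S : edges of G[K] with exactly one endpoint in S
  bd : VSet G → VSet G → ℕ
  bd K S = sumF (λ u → if K u
             then countF (λ v → K v ∧ adj G u v ∧ (toℕ u <ᵇ toℕ v) ∧ (S u xor S v))
             else 0)

  MinDeg : ℕ → VSet G → Set
  MinDeg j S = ∀ v → S v ≡ true → j ≤ deg S v

  -- S is the j-core of G[T]: the largest subgraph of G[T] of minimum degree ≥ j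
  -- (the largest such subgraph is induced, so it is determined by its vertex set)
  IsCore : ℕ → VSet G → VSet G → Set
  IsCore j T S = (S ⊆V T) × MinDeg j S × (∀ S' → S' ⊆V T → MinDeg j S' → S' ⊆V S)

  allV : VSet G
  allV _ = true

-- The 2-core of F is what remains after repeatedly deleting a vertex of degree at most 1, so it
-- suffices that both inequalities survive one such deletion.  Deleting v from S loses one vertex
-- and deg_S v ≤ 1 edges, so the excess does not drop.  Of the deg_K v ≥ b + 2 edges of K at v,
-- the deg_S v edges into S become boundary edges and the remaining ones cease to be, so |∂S|
-- falls by deg_K v − 2 deg_S v ≥ b, which pays for the b lost from b|V(S)|.

module Submission where

open import Defs hiding (sym)
open import Data.Bool using (Bool; true; false; not; _∧_; _∨_; _xor_; if_then_else_)
import Data.Bool as Bool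
open import Data.Bool.Properties using (∧-identityʳ; ∧-zeroʳ; xor-comm; if-eta; ⇔→≡)
open import Data.Fin using (Fin; toℕ; _≟_)
import Data.Fin as Fin using (zero; suc)
open import Data.Fin.Properties using (toℕ-injective; any?)
open import Data.Integer using (+_; _-_; _⊖_) renaming (_≤_ to _≤ℤ_)
import Data.Integer.Properties as ℤ
open import Data.Nat using (ℕ; zero; suc; _+_; _*_; _≤_; _<ᵇ_; _≤?_; z≤n; s≤s)
open import Data.Nat.Properties
  using ( +-identityʳ; +-assoc; +-comm; +-commutativeSemigroup; +-mono-≤; +-monoʳ-≤; +-cancelʳ-≤
        ; *-suc; *-monoʳ-≤; ≤-refl; ≤-trans; ≰⇒>; suc-injective; module ≤-Reasoning)
open import Data.Product using (_×_; _,_; ∃)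
open import Function using (_∘_)
open import Function.Bundles using (mk⇔)
open import Relation.Nullary using (Dec; does; yes; no; contradiction)
open import Relation.Nullary.Decidable using (dec-true; dec-false; _×-dec_)
open import Relation.Binary.PropositionalEquality hiding ([_])
open import Algebra.Properties.CommutativeSemigroup +-commutativeSemigroup
  using (interchange) renaming (xy∙z≈xz∙y to +-swapʳ)

[_] : Bool → ℕ
[ b ] = if b then 1 else 0

sumF-cong : ∀ {m} {f g : Fin m → ℕ} → f ≗ g → sumF f ≡ sumF g
sumF-cong {zero}  f≗g = refl
sumF-cong {suc m} f≗g = cong₂ _+_ (f≗g Fin.zero) (sumF-cong (f≗g ∘ Fin.suc))

sumF-zero : ∀ m → sumF {m} (λ _ → 0) ≡ 0
sumF-zero zero    = refl
sumF-zero (suc m) = sumF-zero m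

sumF-+ : ∀ {m} (f g : Fin m → ℕ) → sumF (λ i → f i + g i) ≡ sumF f + sumF g
sumF-+ {zero}  f g = refl
sumF-+ {suc m} f g = begin
  f₀ + g₀ + sumF (λ i → f (Fin.suc i) + g (Fin.suc i))
    ≡⟨ cong (λ r → f₀ + g₀ + r) (sumF-+ (f ∘ Fin.suc) (g ∘ Fin.suc)) ⟩
  f₀ + g₀ + (sumF (f ∘ Fin.suc) + sumF (g ∘ Fin.suc))
    ≡⟨ interchange f₀ g₀ _ _ ⟩
  f₀ + sumF (f ∘ Fin.suc) + (g₀ + sumF (g ∘ Fin.suc))
    ∎
  where
  open ≡-Reasoning
  f₀ = f Fin.zero
  g₀ = g Fin.zero

sumF-if : ∀ {m} b (f : Fin m → ℕ) → (if b then sumF f else 0) ≡ sumF (λ i → if b then f i else 0)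
sumF-if     true  f = refl
sumF-if {m} false f = sym (sumF-zero m)

sumF-delta : ∀ {m} (v : Fin m) (f : Fin m → ℕ) →
             sumF (λ u → if does (u ≟ v) then f u else 0) ≡ f v
sumF-delta {suc m} Fin.zero    f = trans (cong (_+_ (f Fin.zero)) (sumF-zero m)) (+-identityʳ _)
sumF-delta {suc m} (Fin.suc v) f = sumF-delta v (f ∘ Fin.suc)

countF-mono : ∀ {m} {f g : Fin m → Bool} → (∀ u → f u ≡ true → g u ≡ true) → countF f ≤ countF g
countF-mono {zero}      f⊆g = z≤n
countF-mono {suc m} {f} f⊆g = +-mono-≤ (bit (f Fin.zero) (f⊆g Fin.zero)) (countF-mono (f⊆g ∘ Fin.suc))
  where
  bit : ∀ {c} a → (a ≡ true → c ≡ true) → [ a ] ≤ [ c ]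
  bit false _   = z≤n
  bit true  a⇒c rewrite a⇒c refl = ≤-refl

≢⇒if<ᵇ+if>ᵇ : ∀ {a c} x → a ≢ c → (if a <ᵇ c then x else 0) + (if c <ᵇ a then x else 0) ≡ x
≢⇒if<ᵇ+if>ᵇ {zero}  {zero}  x a≢c = contradiction refl a≢c
≢⇒if<ᵇ+if>ᵇ {zero}  {suc c} x a≢c = +-identityʳ x
≢⇒if<ᵇ+if>ᵇ {suc a} {zero}  x a≢c = refl
≢⇒if<ᵇ+if>ᵇ {suc a} {suc c} x a≢c = ≢⇒if<ᵇ+if>ᵇ x (a≢c ∘ cong suc)

∧-swapˡ : ∀ a b c → a ∧ (b ∧ c) ≡ b ∧ (a ∧ c)
∧-swapˡ true  b c = refl
∧-swapˡ false b c = sym (∧-zeroʳ b)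

module _ {m : ℕ} where

  sumF< : (Fin m → Fin m → ℕ) → ℕ
  sumF< g = sumF λ u → sumF λ w → if toℕ u <ᵇ toℕ w then g u w else 0

  avoid : Fin m → (Fin m → Fin m → ℕ) → Fin m → Fin m → ℕ
  avoid v g u w = if does (u ≟ v) ∨ does (w ≟ v) then 0 else g u w

  -- A pair {v, w} is counted once, as (v, w) or as (w, v) according to toℕ, so by symmetry the
  -- pairs meeting v contribute exactly the row g v.
  sumF<-avoid : ∀ (g : Fin m → Fin m → ℕ) v → (∀ u w → g u w ≡ g w u) → g v v ≡ 0 →
                sumF< g ≡ sumF< (avoid v g) + sumF (g v)
  sumF<-avoid g v g-sym g-irrefl = begin
    sumF (λ u → sumF (t u))
      ≡⟨ sumF-cong (λ u → sumF-cong (split u)) ⟩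
    sumF (λ u → sumF (λ w → t′ u w + row u w + col u w))
      ≡⟨ sumF-cong (λ u → sumF-+₃ (t′ u) (row u) (col u)) ⟩
    sumF (λ u → sumF (t′ u) + sumF (row u) + sumF (col u))
      ≡⟨ sumF-+₃ (λ u → sumF (t′ u)) (λ u → sumF (row u)) (λ u → sumF (col u)) ⟩
    sumF< (avoid v g) + sumF (λ u → sumF (row u)) + sumF (λ u → sumF (col u))
      ≡⟨ cong₂ (λ r c → sumF< (avoid v g) + r + c) row-total col-total ⟩
    sumF< (avoid v g) + sumF (t v) + sumF (λ w → t w v)
      ≡⟨ +-assoc (sumF< (avoid v g)) (sumF (t v)) _ ⟩
    sumF< (avoid v g) + (sumF (t v) + sumF (λ w → t w v))
      ≡⟨ cong (_+_ (sumF< (avoid v g))) (sym (sumF-+ (t v) (λ w → t w v))) ⟩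
    sumF< (avoid v g) + sumF (λ w → t v w + t w v)
      ≡⟨ cong (_+_ (sumF< (avoid v g))) (sumF-cong either-order) ⟩
    sumF< (avoid v g) + sumF (g v)
      ∎
    where
    open ≡-Reasoning
    t t′ row col : Fin m → Fin m → ℕ
    t   u w = if toℕ u <ᵇ toℕ w then g u w else 0
    t′  u w = if toℕ u <ᵇ toℕ w then avoid v g u w else 0
    row u w = if does (u ≟ v) then t u w else 0
    col u w = if does (w ≟ v) then t u w else 0

    sumF-+₃ : ∀ {k} (f g h : Fin k → ℕ) → sumF (λ i → f i + g i + h i) ≡ sumF f + sumF g + sumF h
    sumF-+₃ f g h = trans (sumF-+ _ h) (cong (_+ sumF h) (sumF-+ f g))

    split : ∀ u w → t u w ≡ t′ u w + row u w + col u w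
    split u w with u ≟ v | w ≟ v
    ... | yes refl | yes refl rewrite g-irrefl | if-eta (toℕ v <ᵇ toℕ v) {0} = refl
    ... | yes refl | no _     rewrite if-eta (toℕ v <ᵇ toℕ w) {0} = sym (+-identityʳ _)
    ... | no _     | yes refl rewrite if-eta (toℕ u <ᵇ toℕ v) {0} = refl
    ... | no _     | no _     = sym (trans (+-identityʳ _) (+-identityʳ _))

    row-total : sumF (λ u → sumF (row u)) ≡ sumF (t v)
    row-total = trans (sumF-cong λ u → sym (sumF-if (does (u ≟ v)) (t u)))
                      (sumF-delta v (λ u → sumF (t u)))

    col-total : sumF (λ u → sumF (col u)) ≡ sumF (λ u → t u v)
    col-total = sumF-cong λ u → sumF-delta v (t u)

    either-order : ∀ w → t v w + t w v ≡ g v w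
    either-order w with w ≟ v
    ... | yes refl rewrite g-irrefl | if-eta (toℕ v <ᵇ toℕ v) {0} = refl
    ... | no w≢v   rewrite g-sym w v = ≢⇒if<ᵇ+if>ᵇ (g v w) (w≢v ∘ sym ∘ toℕ-injective)

  sumF<-avoid-cong : ∀ {g g′ : Fin m → Fin m → ℕ} v → (∀ {u w} → u ≢ v → w ≢ v → g u w ≡ g′ u w) →
                     sumF< (avoid v g) ≡ sumF< (avoid v g′)
  sumF<-avoid-cong {g} {g′} v g≡g′ =
    sumF-cong λ u → sumF-cong λ w → cong (λ x → if toℕ u <ᵇ toℕ w then x else 0) (agree u w)
    where
    agree : ∀ u w → avoid v g u w ≡ avoid v g′ u w
    agree u w with u ≟ v | w ≟ v
    ... | yes _  | _      = refl
    ... | no _   | yes _  = refl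
    ... | no u≢v | no w≢v = g≡g′ u≢v w≢v

  sumF<-swap-row : ∀ {g g′ : Fin m → Fin m → ℕ} v →
                   (∀ u w → g u w ≡ g w u) → g v v ≡ 0 → (∀ u w → g′ u w ≡ g′ w u) → g′ v v ≡ 0 →
                   (∀ {u w} → u ≢ v → w ≢ v → g u w ≡ g′ u w) →
                   sumF< g + sumF (g′ v) ≡ sumF< g′ + sumF (g v)
  sumF<-swap-row {g} {g′} v g-sym g-irrefl g′-sym g′-irrefl g≡g′ = begin
    sumF< g + sumF (g′ v)
      ≡⟨ cong (_+ sumF (g′ v)) (sumF<-avoid g v g-sym g-irrefl) ⟩
    sumF< (avoid v g) + sumF (g v) + sumF (g′ v)
      ≡⟨ cong (λ a → a + sumF (g v) + sumF (g′ v)) (sumF<-avoid-cong v g≡g′) ⟩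
    sumF< (avoid v g′) + sumF (g v) + sumF (g′ v)
      ≡⟨ +-swapʳ (sumF< (avoid v g′)) (sumF (g v)) (sumF (g′ v)) ⟩
    sumF< (avoid v g′) + sumF (g′ v) + sumF (g v)
      ≡⟨ cong (_+ sumF (g v)) (sumF<-avoid g′ v g′-sym g′-irrefl) ⟨
    sumF< g′ + sumF (g v)
      ∎
    where open ≡-Reasoning

  _─_ : (Fin m → Bool) → Fin m → Fin m → Bool
  (S ─ v) u = if does (u ≟ v) then false else S u

  ─-self : ∀ S v → (S ─ v) v ≡ false
  ─-self S v rewrite dec-true (v ≟ v) refl = refl

  ─-other : ∀ S {v u} → u ≢ v → (S ─ v) u ≡ S u
  ─-other S {v} {u} u≢v rewrite dec-false (u ≟ v) u≢v = refl

  ─-⊆ : ∀ S v {u} → (S ─ v) u ≡ true → S u ≡ true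
  ─-⊆ S v {u} with u ≟ v
  ... | yes refl = λ ()
  ... | no _     = λ Su → Su

  countF-─ : ∀ S {v} → S v ≡ true → countF S ≡ suc (countF (S ─ v))
  countF-─ S {v} Sv = begin
    countF S
      ≡⟨ sumF-cong split ⟩
    sumF (λ u → [ (S ─ v) u ] + (if does (u ≟ v) then [ S u ] else 0))
      ≡⟨ sumF-+ (λ u → [ (S ─ v) u ]) _ ⟩
    countF (S ─ v) + sumF (λ u → if does (u ≟ v) then [ S u ] else 0)
      ≡⟨ cong (_+_ (countF (S ─ v))) (sumF-delta v (λ u → [ S u ])) ⟩
    countF (S ─ v) + [ S v ]
      ≡⟨ cong (λ b → countF (S ─ v) + [ b ]) Sv ⟩
    countF (S ─ v) + 1
      ≡⟨ +-comm (countF (S ─ v)) 1 ⟩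
    suc (countF (S ─ v))
      ∎
    where
    open ≡-Reasoning
    split : ∀ u → [ S u ] ≡ [ (S ─ v) u ] + (if does (u ≟ v) then [ S u ] else 0)
    split u with u ≟ v
    ... | yes refl = refl
    ... | no _     = sym (+-identityʳ _)

module _ (G : Graph) where

  edge : VSet G → Fin (n G) → Fin (n G) → ℕ
  edge S u w = [ S u ∧ (S w ∧ adj G u w) ]

  cut : VSet G → VSet G → Fin (n G) → Fin (n G) → ℕ
  cut K S u w = [ K u ∧ (K w ∧ (adj G u w ∧ (S u xor S w))) ]

  edges≡sumF<-edge : ∀ S → edges G S ≡ sumF< (edge S)
  edges≡sumF<-edge S = sumF-cong λ u →
    trans (sumF-if (S u) λ w → [ S w ∧ (adj G u w ∧ (toℕ u <ᵇ toℕ w)) ])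
          (sumF-cong λ w → move-< (S u) (S w) (adj G u w) (toℕ u <ᵇ toℕ w))
    where
    move-< : ∀ a b c l → (if a then [ b ∧ (c ∧ l) ] else 0) ≡ (if l then [ a ∧ (b ∧ c) ] else 0)
    move-< true  b c true  rewrite ∧-identityʳ c = refl
    move-< true  b c false rewrite ∧-zeroʳ c | ∧-zeroʳ b = refl
    move-< false b c l     = sym (if-eta l)

  bd≡sumF<-cut : ∀ K S → bd G K S ≡ sumF< (cut K S)
  bd≡sumF<-cut K S = sumF-cong λ u →
    trans (sumF-if (K u) λ w → [ K w ∧ (adj G u w ∧ ((toℕ u <ᵇ toℕ w) ∧ (S u xor S w))) ])
          (sumF-cong λ w → move-< (K u) (K w) (adj G u w) (toℕ u <ᵇ toℕ w) (S u xor S w))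
    where
    move-< : ∀ a b c l x →
             (if a then [ b ∧ (c ∧ (l ∧ x)) ] else 0) ≡ (if l then [ a ∧ (b ∧ (c ∧ x)) ] else 0)
    move-< true  b c true  x = refl
    move-< true  b c false x rewrite ∧-zeroʳ c | ∧-zeroʳ b = refl
    move-< false b c l     x = sym (if-eta l)

  edge-sym : ∀ S u w → edge S u w ≡ edge S w u
  edge-sym S u w rewrite Graph.sym G u w = cong [_] (∧-swapˡ (S u) (S w) (adj G w u))

  edge-irrefl : ∀ S v → edge S v v ≡ 0
  edge-irrefl S v rewrite irrefl G v | ∧-zeroʳ (S v) | ∧-zeroʳ (S v) = refl

  cut-sym : ∀ K S u w → cut K S u w ≡ cut K S w u
  cut-sym K S u w rewrite Graph.sym G u w | xor-comm (S u) (S w) =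
    cong [_] (∧-swapˡ (K u) (K w) (adj G w u ∧ (S w xor S u)))

  cut-irrefl : ∀ K S v → cut K S v v ≡ 0
  cut-irrefl K S v rewrite irrefl G v | ∧-zeroʳ (K v) | ∧-zeroʳ (K v) = refl

  deg-─ : ∀ S v → deg G (S ─ v) v ≡ deg G S v
  deg-─ S v = sumF-cong same
    where
    same : ∀ w → [ (S ─ v) w ∧ adj G v w ] ≡ [ S w ∧ adj G v w ]
    same w with w ≟ v
    ... | yes refl rewrite irrefl G v | ∧-zeroʳ (S v) = refl
    ... | no _     = refl

  deg-mono : ∀ {S T} → _⊆V_ G S T → ∀ v → deg G S v ≤ deg G T v
  deg-mono S⊆T v = countF-mono λ w → ∧-monoˡ (S⊆T w)
    where
    ∧-monoˡ : ∀ {a a′ c} → (a ≡ true → a′ ≡ true) → a ∧ c ≡ true → a′ ∧ c ≡ true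
    ∧-monoˡ {true} a⇒a′ ac rewrite a⇒a′ refl = ac

  sumF-edge-row : ∀ S {v} → S v ≡ true → sumF (edge S v) ≡ deg G S v
  sumF-edge-row S {v} Sv = sumF-cong λ w → cong (λ b → [ b ∧ (S w ∧ adj G v w) ]) Sv

  sumF-edge-row-─ : ∀ S v → sumF (edge (S ─ v) v) ≡ 0
  sumF-edge-row-─ S v =
    trans (sumF-cong λ w → cong (λ b → [ b ∧ ((S ─ v) w ∧ adj G v w) ]) (─-self S v)) (sumF-zero (n G))

  sumF-cut-row-in : ∀ K S {v} → _⊆V_ G S K → S v ≡ true →
                    sumF (cut K S v) + deg G S v ≡ deg G K v
  sumF-cut-row-in K S {v} S⊆K Sv =
    trans (sym (sumF-+ (cut K S v) λ w → [ S w ∧ adj G v w ])) (sumF-cong split)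
    where
    split-bool : ∀ k a s → (s ≡ true → k ≡ true) → [ k ∧ (a ∧ not s) ] + [ s ∧ a ] ≡ [ k ∧ a ]
    split-bool k a     false _   rewrite ∧-identityʳ a = +-identityʳ _
    split-bool k false true  _   rewrite ∧-zeroʳ k = refl
    split-bool k true  true  s⇒k rewrite s⇒k refl = refl
    split : ∀ w → cut K S v w + [ S w ∧ adj G v w ] ≡ [ K w ∧ adj G v w ]
    split w rewrite S⊆K v Sv | Sv = split-bool (K w) (adj G v w) (S w) (S⊆K w)

  sumF-cut-row-out : ∀ K S {v} → _⊆V_ G S K → K v ≡ true → S v ≡ false →
                     sumF (cut K S v) ≡ deg G S v
  sumF-cut-row-out K S {v} S⊆K Kv Sv = sumF-cong inside
    where
    inside-bool : ∀ k a s → (s ≡ true → k ≡ true) → [ k ∧ (a ∧ s) ] ≡ [ s ∧ a ]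
    inside-bool k a false _   rewrite ∧-zeroʳ a | ∧-zeroʳ k = refl
    inside-bool k a true  s⇒k rewrite s⇒k refl | ∧-identityʳ a = refl
    inside : ∀ w → cut K S v w ≡ [ S w ∧ adj G v w ]
    inside w rewrite Kv | Sv = inside-bool (K w) (adj G v w) (S w) (S⊆K w)

  edges-─ : ∀ S {v} → S v ≡ true → edges G S ≡ edges G (S ─ v) + deg G S v
  edges-─ S {v} Sv = begin
    edges G S
      ≡⟨ +-identityʳ (edges G S) ⟨
    edges G S + 0
      ≡⟨ cong₂ _+_ (edges≡sumF<-edge S) (sym (sumF-edge-row-─ S v)) ⟩
    sumF< (edge S) + sumF (edge (S ─ v) v)
      ≡⟨ sumF<-swap-row v (edge-sym S) (edge-irrefl S v) (edge-sym (S ─ v)) (edge-irrefl (S ─ v) v) off-v ⟩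
    sumF< (edge (S ─ v)) + sumF (edge S v)
      ≡⟨ cong₂ _+_ (sym (edges≡sumF<-edge (S ─ v))) (sumF-edge-row S Sv) ⟩
    edges G (S ─ v) + deg G S v
      ∎
    where
    open ≡-Reasoning
    off-v : ∀ {u w} → u ≢ v → w ≢ v → edge S u w ≡ edge (S ─ v) u w
    off-v u≢v w≢v rewrite ─-other S u≢v | ─-other S w≢v = refl

  bd-─ : ∀ K S {v} → _⊆V_ G S K → S v ≡ true →
         bd G K (S ─ v) + deg G K v ≡ bd G K S + 2 * deg G S v
  bd-─ K S {v} S⊆K Sv = begin
    bd G K S′ + deg G K v
      ≡⟨ cong (_+_ (bd G K S′)) (sumF-cut-row-in K S S⊆K Sv) ⟨
    bd G K S′ + (sumF (cut K S v) + deg G S v)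
      ≡⟨ +-assoc (bd G K S′) _ _ ⟨
    bd G K S′ + sumF (cut K S v) + deg G S v
      ≡⟨ cong (_+ deg G S v) exchange ⟨
    bd G K S + deg G S′ v + deg G S v
      ≡⟨ cong (λ d → bd G K S + d + deg G S v) (deg-─ S v) ⟩
    bd G K S + deg G S v + deg G S v
      ≡⟨ +-assoc (bd G K S) _ _ ⟩
    bd G K S + (deg G S v + deg G S v)
      ≡⟨ cong (λ d → bd G K S + (deg G S v + d)) (+-identityʳ (deg G S v)) ⟨
    bd G K S + 2 * deg G S v
      ∎
    where
    open ≡-Reasoning
    S′ = S ─ v

    off-v : ∀ {u w} → u ≢ v → w ≢ v → cut K S u w ≡ cut K S′ u w
    off-v u≢v w≢v rewrite ─-other S u≢v | ─-other S w≢v = refl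

    row-out : sumF (cut K S′ v) ≡ deg G S′ v
    row-out = sumF-cut-row-out K S′ (λ u → S⊆K u ∘ ─-⊆ S v) (S⊆K v Sv) (─-self S v)

    exchange : bd G K S + deg G S′ v ≡ bd G K S′ + sumF (cut K S v)
    exchange = begin
      bd G K S + deg G S′ v
        ≡⟨ cong₂ _+_ (bd≡sumF<-cut K S) (sym row-out) ⟩
      sumF< (cut K S) + sumF (cut K S′ v)
        ≡⟨ sumF<-swap-row v (cut-sym K S) (cut-irrefl K S v) (cut-sym K S′) (cut-irrefl K S′ v) off-v ⟩
      sumF< (cut K S′) + sumF (cut K S v)
        ≡⟨ cong (_+ sumF (cut K S v)) (bd≡sumF<-cut K S′) ⟨
      bd G K S′ + sumF (cut K S v)
        ∎

  exc-─ : ∀ S {v} → S v ≡ true → deg G S v ≤ 1 → exc G S ≤ℤ exc G (S ─ v)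
  exc-─ S {v} Sv d≤1 rewrite edges-─ S Sv | countF-─ S Sv = begin
    + (e + d) - + suc s  ≡⟨ ℤ.m-n≡m⊖n (e + d) (suc s) ⟩
    (e + d) ⊖ suc s      ≤⟨ ℤ.⊖-monoˡ-≤ (suc s) (+-monoʳ-≤ e d≤1) ⟩
    (e + 1) ⊖ suc s      ≡⟨ cong (_⊖ suc s) (+-comm e 1) ⟩
    suc e ⊖ suc s        ≡⟨ ℤ.[1+m]⊖[1+n]≡m⊖n e s ⟩
    e ⊖ s                ≡⟨ ℤ.m-n≡m⊖n e s ⟨
    + e - + s            ∎
    where
    open ℤ.≤-Reasoning
    e = edges G (S ─ v)
    d = deg G S v
    s = size G (S ─ v)

  bd-─-≤ : ∀ {b} K S {v} → _⊆V_ G S K → S v ≡ true → deg G S v ≤ 1 → b + 2 ≤ deg G K v →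
           bd G K S ≤ b * size G S → bd G K (S ─ v) ≤ b * size G (S ─ v)
  bd-─-≤ {b} K S {v} S⊆K Sv d≤1 b+2≤dK bd≤ = +-cancelʳ-≤ (b + 2) (bd G K (S ─ v)) (b * s) (begin
    bd G K (S ─ v) + (b + 2)    ≤⟨ +-monoʳ-≤ (bd G K (S ─ v)) b+2≤dK ⟩
    bd G K (S ─ v) + deg G K v  ≡⟨ bd-─ K S S⊆K Sv ⟩
    bd G K S + 2 * deg G S v    ≤⟨ +-mono-≤ bd≤ (*-monoʳ-≤ 2 d≤1) ⟩
    b * size G S + 2            ≡⟨ cong (λ t → b * t + 2) (countF-─ S Sv) ⟩
    b * suc s + 2               ≡⟨ cong (_+ 2) (trans (*-suc b s) (+-comm b (b * s))) ⟩
    b * s + b + 2               ≡⟨ +-assoc (b * s) b 2 ⟩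
    b * s + (b + 2)             ∎)
    where
    open ≤-Reasoning
    s = size G (S ─ v)

  size-cong : ∀ {S S′} → S ≗ S′ → size G S ≡ size G S′
  size-cong S≗S′ = sumF-cong (cong [_] ∘ S≗S′)

  edges-cong : ∀ {S S′} → S ≗ S′ → edges G S ≡ edges G S′
  edges-cong S≗S′ = sumF-cong λ u → cong₂ (λ a c → if a then c else 0) (S≗S′ u)
    (sumF-cong λ w → cong (λ a → [ a ∧ (adj G u w ∧ (toℕ u <ᵇ toℕ w)) ]) (S≗S′ w))

  exc-cong : ∀ {S S′} → S ≗ S′ → exc G S ≡ exc G S′
  exc-cong S≗S′ = cong₂ (λ e s → + e - + s) (edges-cong S≗S′) (size-cong S≗S′)

  bd-cong : ∀ K {S S′} → S ≗ S′ → bd G K S ≡ bd G K S′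
  bd-cong K S≗S′ = sumF-cong λ u → cong (λ c → if K u then c else 0)
    (sumF-cong λ w → cong₂ (λ a c → [ K w ∧ (adj G u w ∧ ((toℕ u <ᵇ toℕ w) ∧ (a xor c))) ])
                           (S≗S′ u) (S≗S′ w))

  peel-to-2-core : ∀ {F C} (P : VSet G → Set) →
                   (∀ {S S′} → S ≗ S′ → P S → P S′) →
                   (∀ {S v} → _⊆V_ G S F → S v ≡ true → deg G S v ≤ 1 → P S → P (S ─ v)) →
                   IsCore G 2 F C → P F → P C
  peel-to-2-core {F} {C} P P-resp P-peel (C⊆F , C-deg , C-max) =
    peel (size G F) F refl (λ _ Fu → Fu) C⊆F
    where
    low-degree? : ∀ S → Dec (∃ λ v → S v ≡ true × deg G S v ≤ 1)
    low-degree? S = any? λ v → (S v Bool.≟ true) ×-dec (deg G S v ≤? 1)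

    peel : ∀ s S → size G S ≡ s → _⊆V_ G S F → _⊆V_ G C S → P S → P C
    peel s S |S| S⊆F C⊆S PS with low-degree? S
    ... | no none = P-resp (λ u → ⇔→≡ (mk⇔ (S⊆C u) (C⊆S u))) PS
      where
      S⊆C : _⊆V_ G S C
      S⊆C = C-max S S⊆F λ v Sv → ≰⇒> λ d≤1 → none (v , Sv , d≤1)
    peel zero    S |S| S⊆F C⊆S PS | yes (v , Sv , _) with () ← trans (sym |S|) (countF-─ S Sv)
    peel (suc s) S |S| S⊆F C⊆S PS | yes (v , Sv , d≤1) =
      peel s (S ─ v) (suc-injective (trans (sym (countF-─ S Sv)) |S|))
           (λ u → S⊆F u ∘ ─-⊆ S v) C⊆S─v (P-peel S⊆F Sv d≤1 PS)
      where
      C⊆S─v : _⊆V_ G C (S ─ v)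
      C⊆S─v u Cu with u ≟ v
      ... | yes refl = contradiction (≤-trans (C-deg v Cu) (≤-trans (deg-mono C⊆S v) d≤1)) λ { (s≤s ()) }
      ... | no _     = C⊆S u Cu

-- The hypotheses 1 ≤ b and 0 ≤ exc F only guarantee that C is nonempty; the inequalities hold
-- without them.
claim16 : (G : Graph) (b : ℕ) → 1 ≤ b →
    (K F C : VSet G) →
    IsCore G (b + 2) (allV G) K →
    _⊆V_ G F K →
    + 0 ≤ℤ exc G F →
    bd G K F ≤ b * size G F →
    IsCore G 2 F C →
    (exc G F ≤ℤ exc G C) × (bd G K C ≤ b * size G C)
claim16 G b _ K F C (_ , K-deg , _) F⊆K _ bdF≤ C-core =
  peel-to-2-core G Invariant invariant-resp invariant-peel C-core (ℤ.≤-refl , bdF≤)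
  where
  Invariant : VSet G → Set
  Invariant S = (exc G F ≤ℤ exc G S) × (bd G K S ≤ b * size G S)

  invariant-resp : ∀ {S S′} → S ≗ S′ → Invariant S → Invariant S′
  invariant-resp S≗S′ (excF≤ , bd≤) =
    subst (exc G F ≤ℤ_) (exc-cong G S≗S′) excF≤ ,
    subst₂ (λ x y → x ≤ b * y) (bd-cong G K S≗S′) (size-cong G S≗S′) bd≤

  invariant-peel : ∀ {S v} → _⊆V_ G S F → S v ≡ true → deg G S v ≤ 1 → Invariant S → Invariant (S ─ v)
  invariant-peel {S} {v} S⊆F Sv d≤1 (excF≤ , bd≤) =
    ℤ.≤-trans excF≤ (exc-─ G S Sv d≤1) ,
    bd-─-≤ G K S S⊆K Sv d≤1 (K-deg v (S⊆K v Sv)) bd≤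
    where
    S⊆K : _⊆V_ G S K
    S⊆K u = F⊆K u ∘ S⊆F u
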